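{- For every integer $a>0$, \[F(-a)=-\frac{1}{(qt)^{a-1}}F(a-2).\]
   Context: Let $q,t$ be indeterminates. For an integer $m$, $F(m)$ is defined as $\sum_T z_2^{m}\mathrm{wt}(T)$ over the two standard Young tableaux $T$ with $2$ boxes, where $z_2=q$ if $2$ lies in row 1, column 2 and $z_2=t$ if it lies in row 2, column 1, and $\mathrm{wt}(T)=\frac{1}{(1-z_2^{ -1})(1-qt/z_2)}\cdot\frac{(1-1/z_2)(1-qt/z_2)}{(1-q/z_2)(1-t/z_2)}$ with vanishing individual factors omitted. (This is the $n=2$ case of $F(a_2,\dots,a_n)=\sum_T z_2^{a_2}\cdots z_n^{a_n}\mathrm{wt}(T)$ with $z_i=q^{c-1}t^{r-1}$ for the box $(r,c)$ of $i$ and $\mathrm{wt}(T)=\prod_{i=2}^{n}\frac{1}{(1-z_i^{ -1})(1-qtz_{i-1}/z_i)}\prod_{i<j}\frac{(1-z_i/z_j)(1-qtz_i/z_j)}{(1-qz_i/z_j)(1-tz_i/z_j)}$.) -}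

module Defs where

open import Level using (Level; suc; _⊔_)
open import Algebra.Bundles using (CommutativeRing)
open import Data.Integer as ℤ using (ℤ; +_; -[1+_]; 0ℤ; 1ℤ)
open import Data.Nat as ℕ using (ℕ)
open import Data.Product using (_×_; _,_)
open import Data.Bool using (Bool; true; false; if_then_else_; _∧_)
open import Relation.Nullary using (¬_; does)

record Field (c ℓ : Level) : Set (suc (c ⊔ ℓ)) where
  field
    commutativeRing : CommutativeRing c ℓ
  open CommutativeRing commutativeRing public
  field
    _⁻¹       : Carrier → Carrier
    1≉0       : ¬ (1# ≈ 0#)
    ⁻¹-inverse : ∀ x → ¬ (x ≈ 0#) → x * (x ⁻¹) ≈ 1#

-- Monomials q^i t^j, recorded symbolically by their exponent pair (i , j).
Monomial : Set
Monomial = ℤ × ℤ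

mono-one : Monomial
mono-one = (0ℤ , 0ℤ)

_·ᵐ_ : Monomial → Monomial → Monomial
(i , j) ·ᵐ (k , l) = (i ℤ.+ k , j ℤ.+ l)

_ᵐ^_ : Monomial → ℤ → Monomial
(i , j) ᵐ^ m = (m ℤ.* i , m ℤ.* j)

mono-q mono-t : Monomial
mono-q = (1ℤ , 0ℤ)
mono-t = (0ℤ , 1ℤ)

isOne : Monomial → Bool
isOne (i , j) = does (i ℤ.≟ 0ℤ) ∧ does (j ℤ.≟ 0ℤ)

-- A standard Young tableau with 2 boxes: the box of 2 is either
-- (row 1, column 2) or (row 2, column 1).  (Box of 1 is (1,1).)
data SYT₂ : Set where
  twoInRow1 : SYT₂
  twoInRow2 : SYT₂

-- z_i = q^(c-1) t^(r-1) for the box (r , c) of i.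
z₁ : Monomial
z₁ = (0ℤ , 0ℤ)

z₂ : SYT₂ → Monomial
z₂ twoInRow1 = (1ℤ , 0ℤ)
z₂ twoInRow2 = (0ℤ , 1ℤ)

module Powers {c ℓ : Level} (K : Field c ℓ) where
  open Field K

  _^ℕ_ : Carrier → ℕ → Carrier
  x ^ℕ ℕ.zero  = 1#
  x ^ℕ ℕ.suc n = x * (x ^ℕ n)

  _^ℤ_ : Carrier → ℤ → Carrier
  x ^ℤ (+ n)     = x ^ℕ n
  x ^ℤ -[1+ n ]  = (x ⁻¹) ^ℕ ℕ.suc n

module _ {c ℓ : Level} (K : Field c ℓ) (q t : Field.Carrier K) where
  open Field K
  open Powers K

  ev : Monomial → Carrier
  ev (i , j) = (q ^ℤ i) * (t ^ℤ j)

  -- the factor (1 - m), omitted (replaced by 1) when it vanishes identically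
  fac : Monomial → Carrier
  fac m = if isOne m then 1# else (1# - ev m)

  -- wt(T) for n = 2:
  --  1/((1 - z₂⁻¹)(1 - qt z₁/z₂)) · (1 - z₁/z₂)(1 - qt z₁/z₂) / ((1 - q z₁/z₂)(1 - t z₁/z₂))
  wt : SYT₂ → Carrier
  wt T =
    ((fac (z ᵐ^ ℤ.-1ℤ) * fac (mono-q ·ᵐ (mono-t ·ᵐ r))) ⁻¹)
    * ((fac r * fac (mono-q ·ᵐ (mono-t ·ᵐ r)))
       * ((fac (mono-q ·ᵐ r) * fac (mono-t ·ᵐ r)) ⁻¹))
    where
      z : Monomial
      z = z₂ T
      r : Monomial
      r = z₁ ·ᵐ (z ᵐ^ ℤ.-1ℤ)

  F : ℤ → Carrier
  F m = (ev (z₂ twoInRow1 ᵐ^ m) * wt twoInRow1)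
      + (ev (z₂ twoInRow2 ᵐ^ m) * wt twoInRow2)

-- Both weights are explicit: wt(T) collapses to q/(q − t) for 2 in row 1 and to
-- t/(t − q) for 2 in row 2, so F(m) = (q^(m+1) − t^(m+1))/(q − t).  With
-- a = k + 1 the two sides become (q⁻ᵏ − t⁻ᵏ)/(q − t) and
-- −(qt)⁻ᵏ (qᵏ − tᵏ)/(q − t), which agree because x⁻¹ − y⁻¹ = −x⁻¹y⁻¹(x − y).

module Submission where

open import Defs
open import Level using (Level)
open import Data.Integer as ℤ using (ℤ; +_; -[1+_])
open import Data.Integer.Properties as ℤ using ()
open import Data.Nat using (zero; suc)
open import Relation.Nullary using (¬_)
open import Function.Base using (_∘_)
import Algebra.Properties.AbelianGroup as AbelianGroupProperties
import Algebra.Properties.CommutativeSemigroup as CommutativeSemigroupProperties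
import Algebra.Properties.Ring as RingProperties
import Relation.Binary.Reasoning.Setoid as SetoidReasoning

module FieldProperties {c ℓ : Level} (K : Field c ℓ) where
  open Field K
  open Powers K
  open AbelianGroupProperties +-abelianGroup using (⁻¹-anti-homo‿-; x∙y⁻¹≈ε⇒x≈y)
  open CommutativeSemigroupProperties *-commutativeSemigroup
    using (interchange; xy∙z≈xz∙y; xy∙z≈x∙zy; xy∙z≈y∙zx)
  open RingProperties ring using (-‿distribˡ-*; -‿distribʳ-*; x[y-z]≈xy-xz; [y-z]x≈yx-zx)
  open SetoidReasoning setoid

  x⁻¹*x≈1 : ∀ {x} → x ≉ 0# → x ⁻¹ * x ≈ 1#
  x⁻¹*x≈1 {x} x≉0 = trans (*-comm (x ⁻¹) x) (⁻¹-inverse x x≉0)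

  ⁻¹-cancelˡ : ∀ {x} y → x ≉ 0# → x ⁻¹ * (x * y) ≈ y
  ⁻¹-cancelˡ {x} y x≉0 = begin
    x ⁻¹ * (x * y) ≈⟨ *-assoc (x ⁻¹) x y ⟨
    x ⁻¹ * x * y   ≈⟨ *-congʳ (x⁻¹*x≈1 x≉0) ⟩
    1# * y         ≈⟨ *-identityˡ y ⟩
    y              ∎

  *≈1⇒≉0 : ∀ {x y} → x * y ≈ 1# → x ≉ 0#
  *≈1⇒≉0 {x} {y} xy≈1 x≈0 = 1≉0 (begin
    1#     ≈⟨ xy≈1 ⟨
    x * y  ≈⟨ *-congʳ x≈0 ⟩
    0# * y ≈⟨ zeroˡ y ⟩
    0#     ∎)

  ⁻¹-unique : ∀ {x y} → x * y ≈ 1# → x ⁻¹ ≈ y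
  ⁻¹-unique {x} {y} xy≈1 = begin
    x ⁻¹           ≈⟨ *-identityʳ (x ⁻¹) ⟨
    x ⁻¹ * 1#      ≈⟨ *-congˡ xy≈1 ⟨
    x ⁻¹ * (x * y) ≈⟨ ⁻¹-cancelˡ y (*≈1⇒≉0 xy≈1) ⟩
    y              ∎

  *-nonzero : ∀ {x y} → x ≉ 0# → y ≉ 0# → x * y ≉ 0#
  *-nonzero {x} {y} x≉0 y≉0 xy≈0 = y≉0 (begin
    y              ≈⟨ ⁻¹-cancelˡ y x≉0 ⟨
    x ⁻¹ * (x * y) ≈⟨ *-congˡ xy≈0 ⟩
    x ⁻¹ * 0#      ≈⟨ zeroʳ (x ⁻¹) ⟩
    0#             ∎)

  x≉y⇒x-y≉0 : ∀ {x y} → x ≉ y → x - y ≉ 0#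
  x≉y⇒x-y≉0 {x} {y} x≉y = x≉y ∘ x∙y⁻¹≈ε⇒x≈y x y

  ⁻¹≉1 : ∀ {x} → x ≉ 0# → x ≉ 1# → x ⁻¹ ≉ 1#
  ⁻¹≉1 {x} x≉0 x≉1 x⁻¹≈1 = x≉1 (begin
    x         ≈⟨ *-identityʳ x ⟨
    x * 1#    ≈⟨ *-congˡ x⁻¹≈1 ⟨
    x * x ⁻¹  ≈⟨ ⁻¹-inverse x x≉0 ⟩
    1#        ∎)

  *-inverses : ∀ {x x′ y y′} → x * x′ ≈ 1# → y * y′ ≈ 1# → (x * y) * (x′ * y′) ≈ 1#
  *-inverses {x} {x′} {y} {y′} xx′≈1 yy′≈1 = begin
    (x * y) * (x′ * y′) ≈⟨ interchange x y x′ y′ ⟩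
    (x * x′) * (y * y′) ≈⟨ *-cong xx′≈1 yy′≈1 ⟩
    1# * 1#             ≈⟨ *-identityˡ 1# ⟩
    1#                  ∎

  difference-of-inverses : ∀ {x x′ y y′} → x * x′ ≈ 1# → y * y′ ≈ 1# →
                           x′ - y′ ≈ - (x′ * y′ * (x - y))
  difference-of-inverses {x} {x′} {y} {y′} xx′≈1 yy′≈1 = begin
    x′ - y′                         ≈⟨ ⁻¹-anti-homo‿- y′ x′ ⟨
    - (y′ - x′)                     ≈⟨ -‿cong (+-cong x′y′x≈y′ (-‿cong x′y′y≈x′)) ⟨
    - (x′ * y′ * x - x′ * y′ * y)   ≈⟨ -‿cong (x[y-z]≈xy-xz (x′ * y′) x y) ⟨
    - (x′ * y′ * (x - y))           ∎
    where
    x′y′x≈y′ : x′ * y′ * x ≈ y′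
    x′y′x≈y′ = trans (xy∙z≈y∙zx x′ y′ x)
                 (trans (*-congˡ xx′≈1) (*-identityʳ y′))
    x′y′y≈x′ : x′ * y′ * y ≈ x′
    x′y′y≈x′ = trans (xy∙z≈x∙zy x′ y′ y)
                 (trans (*-congˡ yy′≈1) (*-identityʳ x′))

  [1-yx⁻¹]*x[x-y]⁻¹≈1 : ∀ {x y} → x ≉ 0# → x ≉ y →
                         (1# - y * x ⁻¹) * (x * (x - y) ⁻¹) ≈ 1#
  [1-yx⁻¹]*x[x-y]⁻¹≈1 {x} {y} x≉0 x≉y = begin
    (1# - y * x ⁻¹) * (x * (x - y) ⁻¹) ≈⟨ *-assoc (1# - y * x ⁻¹) x ((x - y) ⁻¹) ⟨
    (1# - y * x ⁻¹) * x * (x - y) ⁻¹   ≈⟨ *-congʳ ([y-z]x≈yx-zx x 1# (y * x ⁻¹)) ⟩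
    (1# * x - y * x ⁻¹ * x) * (x - y) ⁻¹
      ≈⟨ *-congʳ (+-cong (*-identityˡ x) (-‿cong yx⁻¹x≈y)) ⟩
    (x - y) * (x - y) ⁻¹               ≈⟨ ⁻¹-inverse (x - y) (x≉y⇒x-y≉0 x≉y) ⟩
    1#                                 ∎
    where
    yx⁻¹x≈y : y * x ⁻¹ * x ≈ y
    yx⁻¹x≈y = trans (*-assoc y (x ⁻¹) x)
                (trans (*-congˡ (x⁻¹*x≈1 x≉0)) (*-identityʳ y))

  [y-x]⁻¹≈-[x-y]⁻¹ : ∀ {x y} → x ≉ y → (y - x) ⁻¹ ≈ - (x - y) ⁻¹
  [y-x]⁻¹≈-[x-y]⁻¹ {x} {y} x≉y = ⁻¹-unique (begin
    (y - x) * - (x - y) ⁻¹   ≈⟨ -‿distribʳ-* (y - x) ((x - y) ⁻¹) ⟨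
    - ((y - x) * (x - y) ⁻¹) ≈⟨ -‿distribˡ-* (y - x) ((x - y) ⁻¹) ⟩
    - (y - x) * (x - y) ⁻¹   ≈⟨ *-congʳ (⁻¹-anti-homo‿- y x) ⟩
    (x - y) * (x - y) ⁻¹     ≈⟨ ⁻¹-inverse (x - y) (x≉y⇒x-y≉0 x≉y) ⟩
    1#                       ∎)

  ^ℕ-distrib-* : ∀ x y n → (x * y) ^ℕ n ≈ x ^ℕ n * y ^ℕ n
  ^ℕ-distrib-* x y zero    = sym (*-identityˡ 1#)
  ^ℕ-distrib-* x y (suc n) = begin
    (x * y) * (x * y) ^ℕ n          ≈⟨ *-congˡ (^ℕ-distrib-* x y n) ⟩
    (x * y) * (x ^ℕ n * y ^ℕ n)     ≈⟨ interchange x y (x ^ℕ n) (y ^ℕ n) ⟩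
    (x * x ^ℕ n) * (y * y ^ℕ n)     ∎

  ^ℕ-inverse : ∀ {x y} n → x * y ≈ 1# → x ^ℕ n * y ^ℕ n ≈ 1#
  ^ℕ-inverse zero    _     = *-identityˡ 1#
  ^ℕ-inverse (suc n) xy≈1 = *-inverses xy≈1 (^ℕ-inverse n xy≈1)

  ^-[1+k]*x≈x⁻¹^k : ∀ {x} k → x ≉ 0# → x ^ℤ -[1+ k ] * x ≈ (x ⁻¹) ^ℕ k
  ^-[1+k]*x≈x⁻¹^k {x} k x≉0 = begin
    x ⁻¹ * (x ⁻¹) ^ℕ k * x   ≈⟨ xy∙z≈xz∙y (x ⁻¹) ((x ⁻¹) ^ℕ k) x ⟩
    x ⁻¹ * x * (x ⁻¹) ^ℕ k   ≈⟨ *-congʳ (x⁻¹*x≈1 x≉0) ⟩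
    1# * (x ⁻¹) ^ℕ k         ≈⟨ *-identityˡ ((x ⁻¹) ^ℕ k) ⟩
    (x ⁻¹) ^ℕ k              ∎

  ^[1+k-2]*x≈x^k : ∀ {x} k → x ≉ 0# → x ^ℤ (+ suc k ℤ.- + 2) * x ≈ x ^ℕ k
  ^[1+k-2]*x≈x^k zero    x≉0 = ^-[1+k]*x≈x⁻¹^k 0 x≉0
  ^[1+k-2]*x≈x^k (suc k) _   = *-comm _ _

module _ {c ℓ : Level} (K : Field c ℓ) where
  open Field K

  module TwoBoxTableaux (q t : Carrier)
    (q≉0 : q ≉ 0#) (t≉0 : t ≉ 0#) (q≉1 : q ≉ 1#) (t≉1 : t ≉ 1#) (q≉t : q ≉ t)
    where

    open Powers K
    open FieldProperties K
    open RingProperties ring using (-‿distribʳ-*; [y-z]x≈yx-zx)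
    open SetoidReasoning setoid

    1-z≉0 : ∀ {x z} → z ≈ x → x ≉ 1# → 1# - z ≉ 0#
    1-z≉0 z≈x x≉1 = x≉y⇒x-y≉0 λ 1≈z → x≉1 (sym (trans 1≈z z≈x))

    -- The factors (1 − z₂⁻¹)(1 − qt z₁/z₂) of wt cancel against the numerator,
    -- leaving 1/(1 − q z₁/z₂)(1 − t z₁/z₂) with one of these two factors omitted.
    wt-twoInRow1 : wt K q t twoInRow1 ≈ q * (q - t) ⁻¹
    wt-twoInRow1 = begin
      wt K q t twoInRow1                        ≈⟨ ⁻¹-cancelˡ _ (*-nonzero [1-q⁻¹]≉0 [1-t]≉0) ⟩
      (1# * (1# - (q ⁻¹ * 1#) * (t * 1#))) ⁻¹   ≈⟨ ⁻¹-unique C*[q[q-t]⁻¹]≈1 ⟩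
      q * (q - t) ⁻¹                            ∎
      where
      [1-q⁻¹]≉0 : 1# - (q ⁻¹ * 1#) * 1# ≉ 0#
      [1-q⁻¹]≉0 = 1-z≉0 (trans (*-identityʳ _) (*-identityʳ _)) (⁻¹≉1 q≉0 q≉1)
      [1-t]≉0 : 1# - 1# * (t * 1#) ≉ 0#
      [1-t]≉0 = 1-z≉0 (trans (*-identityˡ _) (*-identityʳ t)) t≉1
      C*[q[q-t]⁻¹]≈1 : (1# * (1# - (q ⁻¹ * 1#) * (t * 1#))) * (q * (q - t) ⁻¹) ≈ 1#
      C*[q[q-t]⁻¹]≈1 = trans
        (*-congʳ (trans (*-identityˡ _) (+-congˡ (-‿cong (trans
          (*-cong (*-identityʳ (q ⁻¹)) (*-identityʳ t)) (*-comm (q ⁻¹) t))))))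
        ([1-yx⁻¹]*x[x-y]⁻¹≈1 q≉0 q≉t)

    wt-twoInRow2 : wt K q t twoInRow2 ≈ t * (t - q) ⁻¹
    wt-twoInRow2 = begin
      wt K q t twoInRow2                        ≈⟨ ⁻¹-cancelˡ _ (*-nonzero [1-t⁻¹]≉0 [1-q]≉0) ⟩
      ((1# - (q * 1#) * (t ⁻¹ * 1#)) * 1#) ⁻¹   ≈⟨ ⁻¹-unique C*[t[t-q]⁻¹]≈1 ⟩
      t * (t - q) ⁻¹                            ∎
      where
      [1-t⁻¹]≉0 : 1# - 1# * (t ⁻¹ * 1#) ≉ 0#
      [1-t⁻¹]≉0 = 1-z≉0 (trans (*-identityˡ _) (*-identityʳ _)) (⁻¹≉1 t≉0 t≉1)
      [1-q]≉0 : 1# - (q * 1#) * 1# ≉ 0#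
      [1-q]≉0 = 1-z≉0 (trans (*-identityʳ _) (*-identityʳ q)) q≉1
      C*[t[t-q]⁻¹]≈1 : ((1# - (q * 1#) * (t ⁻¹ * 1#)) * 1#) * (t * (t - q) ⁻¹) ≈ 1#
      C*[t[t-q]⁻¹]≈1 = trans
        (*-congʳ (trans (*-identityʳ _) (+-congˡ (-‿cong
          (*-cong (*-identityʳ q) (*-identityʳ (t ⁻¹)))))))
        ([1-yx⁻¹]*x[x-y]⁻¹≈1 t≉0 (λ t≈q → q≉t (sym t≈q)))

    ev-z₂ᵐ^-twoInRow1 : ∀ m → ev K q t (z₂ twoInRow1 ᵐ^ m) ≈ q ^ℤ m
    ev-z₂ᵐ^-twoInRow1 m rewrite ℤ.*-identityʳ m | ℤ.*-zeroʳ m = *-identityʳ (q ^ℤ m)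

    ev-z₂ᵐ^-twoInRow2 : ∀ m → ev K q t (z₂ twoInRow2 ᵐ^ m) ≈ t ^ℤ m
    ev-z₂ᵐ^-twoInRow2 m rewrite ℤ.*-identityʳ m | ℤ.*-zeroʳ m = *-identityˡ (t ^ℤ m)

    F-closed : ∀ m → F K q t m ≈ (q ^ℤ m * q - t ^ℤ m * t) * (q - t) ⁻¹
    F-closed m = begin
      F K q t m
        ≈⟨ +-cong (*-cong (ev-z₂ᵐ^-twoInRow1 m) wt-twoInRow1)
                  (*-cong (ev-z₂ᵐ^-twoInRow2 m) wt-twoInRow2) ⟩
      q ^ℤ m * (q * d) + t ^ℤ m * (t * (t - q) ⁻¹)
        ≈⟨ +-cong (*-assoc _ _ _) (*-assoc _ _ _) ⟨
      q ^ℤ m * q * d + t ^ℤ m * t * (t - q) ⁻¹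
        ≈⟨ +-congˡ (*-congˡ ([y-x]⁻¹≈-[x-y]⁻¹ q≉t)) ⟩
      q ^ℤ m * q * d + t ^ℤ m * t * - d
        ≈⟨ +-congˡ (-‿distribʳ-* _ _) ⟨
      q ^ℤ m * q * d - t ^ℤ m * t * d
        ≈⟨ [y-z]x≈yx-zx d _ _ ⟨
      (q ^ℤ m * q - t ^ℤ m * t) * d ∎
      where
      d : Carrier
      d = (q - t) ⁻¹

    F-[1+k] : ∀ k → F K q t -[1+ k ] ≈ ((q ⁻¹) ^ℕ k - (t ⁻¹) ^ℕ k) * (q - t) ⁻¹
    F-[1+k] k = trans (F-closed -[1+ k ])
      (*-congʳ (+-cong (^-[1+k]*x≈x⁻¹^k k q≉0) (-‿cong (^-[1+k]*x≈x⁻¹^k k t≉0))))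

    F-[1+k-2] : ∀ k → F K q t (+ suc k ℤ.- + 2) ≈ (q ^ℕ k - t ^ℕ k) * (q - t) ⁻¹
    F-[1+k-2] k = trans (F-closed (+ suc k ℤ.- + 2))
      (*-congʳ (+-cong (^[1+k-2]*x≈x^k k q≉0) (-‿cong (^[1+k-2]*x≈x^k k t≉0))))

proposition2p22 : ∀ {c ℓ : Level} (K : Field c ℓ) (q t : Field.Carrier K) →
    let open Field K in
    let open Powers K in
    ¬ (q ≈ 0#) → ¬ (t ≈ 0#) → ¬ (q ≈ 1#) → ¬ (t ≈ 1#) → ¬ (q ≈ t) →
    (a : ℤ) → ℤ.0ℤ ℤ.< a →
    F K q t (ℤ.- a)
    ≈ - (((q * t) ^ℤ (a ℤ.- ℤ.1ℤ)) ⁻¹ * F K q t (a ℤ.- ℤ.+ 2))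
proposition2p22 K q t q≉0 t≉0 q≉1 t≉1 q≉t (+ zero) (ℤ.+<+ ())
proposition2p22 K q t q≉0 t≉0 q≉1 t≉1 q≉t (+ suc k) _ = begin
  F K q t -[1+ k ]                             ≈⟨ F-[1+k] k ⟩
  (u^k - v^k) * d                              ≈⟨ *-congʳ (difference-of-inverses q^k*u^k≈1 t^k*v^k≈1) ⟩
  - (u^k * v^k * (q ^ℕ k - t ^ℕ k)) * d        ≈⟨ -‿distribˡ-* _ d ⟨
  - (u^k * v^k * (q ^ℕ k - t ^ℕ k) * d)        ≈⟨ -‿cong (*-assoc _ _ d) ⟩
  - (u^k * v^k * ((q ^ℕ k - t ^ℕ k) * d))      ≈⟨ -‿cong (*-cong [qt]^k⁻¹≈u^kv^k (F-[1+k-2] k)) ⟨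
  - (((q * t) ^ℕ k) ⁻¹ * F K q t (+ suc k ℤ.- + 2)) ∎
  where
  open Field K
  open Powers K
  open FieldProperties K
  open TwoBoxTableaux K q t q≉0 t≉0 q≉1 t≉1 q≉t
  open RingProperties ring using (-‿distribˡ-*)
  open SetoidReasoning setoid
  u^k v^k d : Carrier
  u^k = (q ⁻¹) ^ℕ k
  v^k = (t ⁻¹) ^ℕ k
  d = (q - t) ⁻¹
  q^k*u^k≈1 : q ^ℕ k * u^k ≈ 1#
  q^k*u^k≈1 = ^ℕ-inverse k (⁻¹-inverse q q≉0)
  t^k*v^k≈1 : t ^ℕ k * v^k ≈ 1#
  t^k*v^k≈1 = ^ℕ-inverse k (⁻¹-inverse t t≉0)
  [qt]^k⁻¹≈u^kv^k : ((q * t) ^ℕ k) ⁻¹ ≈ u^k * v^k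
  [qt]^k⁻¹≈u^kv^k = ⁻¹-unique
    (trans (*-congʳ (^ℕ-distrib-* q t k)) (*-inverses q^k*u^k≈1 t^k*v^k≈1))
proposition2p22 K q t q≉0 t≉0 q≉1 t≉1 q≉t -[1+ n ] ()
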